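{- There exists an infinite family $\mathcal{F}$ of pairwise intersecting right-angled triangles in $\mathbb{R}^2$, with bounded diameters (there is $R>0$ with $\mathrm{diam}(T)<R$ for all $T\in\mathcal{F}$) and non-zero areas, such that no finite set of points in $\mathbb{R}^2$ meets every triangle of $\mathcal{F}$.
   Context: Triangles are closed and not required to have axis-parallel legs. -}

module Defs where

open import Level using (0ℓ)
open import Data.Product using (Σ; ∃; _×_; _,_)
open import Data.Sum using (_⊎_)
open import Data.List using (List)
open import Data.List.Relation.Unary.Any using (Any)
open import Relation.Nullary using (¬_)
open import Relation.Binary.PropositionalEquality using (_≡_; _≢_)
open import Relation.Binary.Structures using (IsStrictTotalOrder)
open import Algebra.Structures using (IsCommutativeRing)

-- The real numbers, given axiomatically as a complete ordered field
-- (least-upper-bound property).  Any two models are isomorphic, so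
-- quantifying over all models is the same as speaking about ℝ.
record RealField : Set₁ where
  infixl 6 _+_
  infixl 7 _*_
  infix  8 -_
  infix  4 _<_ _≤_
  field
    Carrier : Set
    _+_ _*_ : Carrier → Carrier → Carrier
    -_      : Carrier → Carrier
    0# 1#   : Carrier
    _<_     : Carrier → Carrier → Set
    isCommutativeRing : IsCommutativeRing _≡_ _+_ _*_ -_ 0# 1#
    0≢1     : 0# ≢ 1#
    inverse : ∀ x → x ≢ 0# → Σ Carrier λ y → x * y ≡ 1#
    isStrictTotalOrder : IsStrictTotalOrder _≡_ _<_
    +-mono-< : ∀ {x y} z → x < y → x + z < y + z
    *-pos    : ∀ {x y} → 0# < x → 0# < y → 0# < x * y

  _≤_ : Carrier → Carrier → Set
  x ≤ y = x < y ⊎ x ≡ y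

  field
    lub : (P : Carrier → Set) → (Σ Carrier P) →
          (Σ Carrier λ b → ∀ x → P x → x ≤ b) →
          Σ Carrier λ s → (∀ x → P x → x ≤ s) ×
                          (∀ b → (∀ x → P x → x ≤ b) → s ≤ b)

module Geometry (ℝ : RealField) where
  open RealField ℝ

  _-_ : Carrier → Carrier → Carrier
  x - y = x + (- y)

  Point : Set
  Point = Carrier × Carrier

  -- a triangle given by its three vertices; as a point set it is the
  -- closed convex hull of the vertices
  record Triangle : Set where
    constructor tri
    field
      A B C : Point

  dot : Point → Point → Point → Carrier
  dot (ox , oy) (px , py) (qx , qy) = (px - ox) * (qx - ox) + (py - oy) * (qy - oy)

  dist² : Point → Point → Carrier
  dist² p q = dot p q q

  _∈T_ : Point → Triangle → Set
  (x , y) ∈T tri (ax , ay) (bx , by) (cx , cy) =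
    Σ Carrier λ l → Σ Carrier λ m → Σ Carrier λ n →
      (0# ≤ l) × (0# ≤ m) × (0# ≤ n) × (l + m + n ≡ 1#) ×
      (x ≡ l * ax + m * bx + n * cx) × (y ≡ l * ay + m * by + n * cy)

  RightAngled : Triangle → Set
  RightAngled (tri a b c) = dot a b c ≡ 0# ⊎ dot b a c ≡ 0# ⊎ dot c a b ≡ 0#

  area2 : Triangle → Carrier
  area2 (tri (ax , ay) (bx , by) (cx , cy)) =
    (bx - ax) * (cy - ay) - (by - ay) * (cx - ax)

  NonZeroArea : Triangle → Set
  NonZeroArea t = area2 t ≢ 0#

  Intersect : Triangle → Triangle → Set
  Intersect s t = Σ Point λ p → p ∈T s × p ∈T t

  SameSet : Triangle → Triangle → Set
  SameSet s t = ∀ p → (p ∈T s → p ∈T t) × (p ∈T t → p ∈T s)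

  InfiniteFamily : {I : Set} → (I → Triangle) → Set
  InfiniteFamily {I} F = Σ (ℕ' → I) λ f → ∀ m n → m ≢ n → ¬ SameSet (F (f m)) (F (f n))
    where open import Data.Nat using () renaming (ℕ to ℕ')

  BoundedDiameters : {I : Set} → (I → Triangle) → Set
  BoundedDiameters {I} F = Σ Carrier λ R → (0# < R) ×
    (∀ i p q → p ∈T F i → q ∈T F i → dist² p q < R * R)

  Pierces : {I : Set} → List Point → (I → Triangle) → Set
  Pierces ps F = ∀ i → Any (λ p → p ∈T F i) ps

{-# OPTIONS --safe #-}
-- For 0 < t ≤ 1 let T t be the triangle with vertices (t + 1, t), (t − t², t) and (t, 0), right-angled
-- at (t, 0). It lies in [0, 2] × [0, t] and meets the x-axis only in (t, 0). Any two of them, T s and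
-- T t, share the point (s + t, st): it lies at fraction s along the leg of T t from (t, 0) to (t + 1, t)
-- and at fraction t along the corresponding leg of T s. A point with y ≠ 0, or with y = 0 and x ≠ t,
-- misses T t once t is small enough, so a finite set of points misses T t for all small t. Since T t
-- determines t, the parameters 2⁻ⁿ give infinitely many distinct triangles.
module Submission where

open import Defs
open import Algebra.Bundles using (CommutativeRing)
open import Algebra.Solver.Ring.AlmostCommutativeRing
  using (_-Raw-AlmostCommutative⟶_; fromCommutativeRing)
open import Data.Empty using (⊥-elim)
open import Data.Integer as ℤ using (ℤ; +_; -[1+_])
import Data.Integer.Properties as ℤ
open import Data.List using (List; []; _∷_)
open import Data.List.Relation.Unary.All as All using (All; []; _∷_)
open import Data.Maybe using (map)
open import Data.Nat as ℕ using (ℕ; suc)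
import Data.Nat.Properties as ℕ
open import Data.Product using (Σ; _×_; _,_; proj₁; proj₂)
open import Data.Sum using (inj₁; inj₂)
import Data.Sign as Sign
open import Function using (_∘_)
open import Level using (0ℓ)
open import Relation.Binary.Definitions using (tri<; tri≈; tri>)
open import Relation.Binary.PropositionalEquality using (cong)
open import Relation.Binary.Structures using (IsStrictTotalOrder)
open import Relation.Nullary using (¬_)
open import Relation.Nullary.Decidable using (dec⇒maybe)

-- Ring solver for an arbitrary commutative ring with integer coefficients: the normaliser has to decide
-- which coefficients vanish, which it cannot do with the ring's own elements as coefficients.
module IntegerCoefficients {c ℓ} (R : CommutativeRing c ℓ) where
  open CommutativeRing R
  open import Algebra.Properties.Ring ring using (-0#≈0#; -‿involutive; -‿+-comm; -‿distribˡ-*; -‿distribʳ-*)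
  open import Algebra.Properties.Semiring.Mult.TCOptimised semiring using (1+×; ×-homo-+; ×1-homo-*)
    renaming (_×_ to _·_)
  open import Relation.Binary.Reasoning.Setoid setoid

  -- With the type-checking-optimised `_·_`, `fromℤ (+ 1)` reduces to `1#`, so the solver's
  -- constants agree definitionally with the literals in goals.
  fromℤ : ℤ → Carrier
  fromℤ (+ n)    = n · 1#
  fromℤ -[1+ n ] = - (suc n · 1#)

  1+x-1+y≈x-y : ∀ x y → (1# + x) - (1# + y) ≈ x - y
  1+x-1+y≈x-y x y = begin
    (1# + x) + - (1# + y)   ≈⟨ +-congˡ (-‿+-comm 1# y) ⟨
    (1# + x) + (- 1# + - y) ≈⟨ +-assoc 1# x (- 1# + - y) ⟩
    1# + (x + (- 1# + - y)) ≈⟨ +-congˡ (+-comm x (- 1# + - y)) ⟩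
    1# + ((- 1# + - y) + x) ≈⟨ +-congˡ (+-assoc (- 1#) (- y) x) ⟩
    1# + (- 1# + (- y + x)) ≈⟨ +-assoc 1# (- 1#) (- y + x) ⟨
    (1# + - 1#) + (- y + x) ≈⟨ +-cong (-‿inverseʳ 1#) (+-comm (- y) x) ⟩
    0# + (x - y)            ≈⟨ +-identityˡ (x - y) ⟩
    x - y                   ∎

  fromℤ-homo-⊖ : ∀ m n → fromℤ (m ℤ.⊖ n) ≈ m · 1# - n · 1#
  fromℤ-homo-⊖ m       ℕ.zero  = begin
    fromℤ (m ℤ.⊖ 0)  ≡⟨ cong fromℤ (ℤ.⊖-≥ {m} ℕ.z≤n) ⟩
    m · 1#           ≈⟨ +-identityʳ (m · 1#) ⟨
    m · 1# + 0#      ≈⟨ +-congˡ -0#≈0# ⟨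
    m · 1# - 0#      ∎
  fromℤ-homo-⊖ ℕ.zero  (suc n) = sym (+-identityˡ _)
  fromℤ-homo-⊖ (suc m) (suc n) = begin
    fromℤ (suc m ℤ.⊖ suc n)        ≡⟨ cong fromℤ (ℤ.[1+m]⊖[1+n]≡m⊖n m n) ⟩
    fromℤ (m ℤ.⊖ n)                ≈⟨ fromℤ-homo-⊖ m n ⟩
    m · 1# - n · 1#                ≈⟨ 1+x-1+y≈x-y (m · 1#) (n · 1#) ⟨
    (1# + m · 1#) - (1# + n · 1#)  ≈⟨ +-cong (1+× m 1#) (-‿cong (1+× n 1#)) ⟨
    suc m · 1# - suc n · 1#        ∎

  fromℤ-homo-+ : ∀ i j → fromℤ (i ℤ.+ j) ≈ fromℤ i + fromℤ j
  fromℤ-homo-+ (+ m)    (+ n)    = ×-homo-+ 1# m n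
  fromℤ-homo-+ (+ m)    -[1+ n ] = fromℤ-homo-⊖ m (suc n)
  fromℤ-homo-+ -[1+ m ] (+ n)    = trans (fromℤ-homo-⊖ n (suc m)) (+-comm _ _)
  fromℤ-homo-+ -[1+ m ] -[1+ n ] = begin
    - (suc (suc (m ℕ.+ n)) · 1#)       ≡⟨ cong (λ k → - (suc k · 1#)) (ℕ.+-suc m n) ⟨
    - ((suc m ℕ.+ suc n) · 1#)         ≈⟨ -‿cong (×-homo-+ 1# (suc m) (suc n)) ⟩
    - (suc m · 1# + suc n · 1#)        ≈⟨ -‿+-comm _ _ ⟨
    - (suc m · 1#) + - (suc n · 1#)    ∎

  fromℤ-homo-pos◃ : ∀ n → fromℤ (Sign.+ ℤ.◃ n) ≈ n · 1#
  fromℤ-homo-pos◃ ℕ.zero  = refl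
  fromℤ-homo-pos◃ (suc n) = refl

  fromℤ-homo-neg◃ : ∀ n → fromℤ (Sign.- ℤ.◃ n) ≈ - (n · 1#)
  fromℤ-homo-neg◃ ℕ.zero  = sym -0#≈0#
  fromℤ-homo-neg◃ (suc n) = refl

  fromℤ-homo-* : ∀ i j → fromℤ (i ℤ.* j) ≈ fromℤ i * fromℤ j
  fromℤ-homo-* (+ m)    (+ n)    = trans (fromℤ-homo-pos◃ (m ℕ.* n)) (×1-homo-* m n)
  fromℤ-homo-* (+ m)    -[1+ n ] = begin
    fromℤ (Sign.- ℤ.◃ m ℕ.* suc n)  ≈⟨ fromℤ-homo-neg◃ (m ℕ.* suc n) ⟩
    - ((m ℕ.* suc n) · 1#)          ≈⟨ -‿cong (×1-homo-* m (suc n)) ⟩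
    - (m · 1# * suc n · 1#)         ≈⟨ -‿distribʳ-* _ _ ⟩
    m · 1# * - (suc n · 1#)         ∎
  fromℤ-homo-* -[1+ m ] (+ n)    = begin
    fromℤ (Sign.- ℤ.◃ suc m ℕ.* n)  ≈⟨ fromℤ-homo-neg◃ (suc m ℕ.* n) ⟩
    - ((suc m ℕ.* n) · 1#)          ≈⟨ -‿cong (×1-homo-* (suc m) n) ⟩
    - (suc m · 1# * n · 1#)         ≈⟨ -‿distribˡ-* _ _ ⟩
    - (suc m · 1#) * n · 1#         ∎
  fromℤ-homo-* -[1+ m ] -[1+ n ] = begin
    fromℤ (Sign.+ ℤ.◃ suc m ℕ.* suc n) ≈⟨ fromℤ-homo-pos◃ (suc m ℕ.* suc n) ⟩
    (suc m ℕ.* suc n) · 1#            ≈⟨ ×1-homo-* (suc m) (suc n) ⟩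
    suc m · 1# * suc n · 1#           ≈⟨ -‿involutive _ ⟨
    - - (suc m · 1# * suc n · 1#)     ≈⟨ -‿cong (-‿distribˡ-* _ _) ⟩
    - (- (suc m · 1#) * suc n · 1#)   ≈⟨ -‿distribʳ-* _ _ ⟩
    - (suc m · 1#) * - (suc n · 1#)   ∎

  fromℤ-homo-neg : ∀ i → fromℤ (ℤ.- i) ≈ - fromℤ i
  fromℤ-homo-neg (+ ℕ.zero) = sym -0#≈0#
  fromℤ-homo-neg (+ suc n)  = refl
  fromℤ-homo-neg -[1+ n ]   = sym (-‿involutive _)

  homomorphism : ℤ.+-*-rawRing -Raw-AlmostCommutative⟶ fromCommutativeRing R
  homomorphism = record
    { ⟦_⟧    = fromℤ
    ; +-homo = fromℤ-homo-+
    ; *-homo = fromℤ-homo-*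
    ; -‿homo = fromℤ-homo-neg
    ; 0-homo = refl
    ; 1-homo = refl
    }

  open import Algebra.Solver.Ring ℤ.+-*-rawRing (fromCommutativeRing R) homomorphism
    (λ i j → map (reflexive ∘ cong fromℤ) (dec⇒maybe (i ℤ.≟ j))) public

module Construction (ℝ : RealField) where
  open RealField ℝ
  open Geometry ℝ
  open import Relation.Binary.PropositionalEquality
  open ≡-Reasoning
  private module < = IsStrictTotalOrder isStrictTotalOrder

  commutativeRing : CommutativeRing 0ℓ 0ℓ
  commutativeRing = record { isCommutativeRing = isCommutativeRing }

  open CommutativeRing commutativeRing
    using (+-comm; *-comm; +-identityˡ; *-identityˡ; *-identityʳ; *-assoc; zeroˡ; zeroʳ; -‿inverseʳ; ring)
  open import Algebra.Properties.Ring ring using (-0#≈0#; -‿distribʳ-*; -‿injective)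
  open IntegerCoefficients commutativeRing using (Polynomial; solve; _:=_; con; _:+_; _:*_; :-_; _:-_)

  0ₚ 1ₚ : ∀ {n} → Polynomial n
  0ₚ = con (+ 0)
  1ₚ = con (+ 1)

  2# 3# : Carrier
  2# = 1# + 1#
  3# = 2# + 1#

  y-x+x≡y : ∀ y x → y - x + x ≡ y
  y-x+x≡y = solve 2 (λ y x → y :- x :+ x := y) refl

  <-irrefl : ∀ {x} → ¬ x < x
  <-irrefl = <.irrefl refl

  <-≤-trans : ∀ {x y z} → x < y → y ≤ z → x < z
  <-≤-trans x<y (inj₁ y<z)  = <.trans x<y y<z
  <-≤-trans x<y (inj₂ refl) = x<y

  ≤-<-trans : ∀ {x y z} → x ≤ y → y < z → x < z
  ≤-<-trans (inj₁ x<y)  y<z = <.trans x<y y<z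
  ≤-<-trans (inj₂ refl) y<z = y<z

  ≤-trans : ∀ {x y z} → x ≤ y → y ≤ z → x ≤ z
  ≤-trans (inj₁ x<y)  y≤z = inj₁ (<-≤-trans x<y y≤z)
  ≤-trans (inj₂ refl) y≤z = y≤z

  pos⇒≢0 : ∀ {x} → 0# < x → x ≢ 0#
  pos⇒≢0 0<x x≡0 = <-irrefl (subst (0# <_) x≡0 0<x)

  x<y⇒0<y-x : ∀ {x y} → x < y → 0# < y - x
  x<y⇒0<y-x {x} {y} x<y = subst (_< y - x) (-‿inverseʳ x) (+-mono-< (- x) x<y)

  0<y-x⇒x<y : ∀ {x y} → 0# < y - x → x < y
  0<y-x⇒x<y {x} {y} 0<y-x = subst₂ _<_ (+-identityˡ x) (y-x+x≡y y x) (+-mono-< x 0<y-x)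

  x≤y⇒0≤y-x : ∀ {x y} → x ≤ y → 0# ≤ y - x
  x≤y⇒0≤y-x (inj₁ x<y)      = inj₁ (x<y⇒0<y-x x<y)
  x≤y⇒0≤y-x {x} (inj₂ refl) = inj₂ (sym (-‿inverseʳ x))

  0≤y-x⇒x≤y : ∀ {x y} → 0# ≤ y - x → x ≤ y
  0≤y-x⇒x≤y (inj₁ 0<y-x) = inj₁ (0<y-x⇒x<y 0<y-x)
  0≤y-x⇒x≤y {x} {y} (inj₂ 0≡y-x) = inj₂ (begin
    x           ≡⟨ +-identityˡ x ⟨
    0# + x      ≡⟨ cong (_+ x) 0≡y-x ⟩
    y - x + x   ≡⟨ y-x+x≡y y x ⟩
    y           ∎)

  x<0⇒0<-x : ∀ {x} → x < 0# → 0# < - x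
  x<0⇒0<-x {x} x<0 = subst₂ _<_ (-‿inverseʳ x) (+-identityˡ (- x)) (+-mono-< (- x) x<0)

  ≤-byGap : ∀ {x y g} → y - x ≡ g → 0# ≤ g → x ≤ y
  ≤-byGap y-x≡g 0≤g = 0≤y-x⇒x≤y (subst (0# ≤_) (sym y-x≡g) 0≤g)

  <-byGap : ∀ {x y g} → y - x ≡ g → 0# < g → x < y
  <-byGap y-x≡g 0<g = 0<y-x⇒x<y (subst (0# <_) (sym y-x≡g) 0<g)

  pos+nonNeg⇒pos : ∀ {x y} → 0# < x → 0# ≤ y → 0# < x + y
  pos+nonNeg⇒pos {x} {y} 0<x 0≤y =
    ≤-<-trans (subst (0# ≤_) (sym (+-identityˡ y)) 0≤y) (+-mono-< y 0<x)

  nonNeg+nonNeg⇒nonNeg : ∀ {x y} → 0# ≤ x → 0# ≤ y → 0# ≤ x + y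
  nonNeg+nonNeg⇒nonNeg (inj₁ 0<x) 0≤y = inj₁ (pos+nonNeg⇒pos 0<x 0≤y)
  nonNeg+nonNeg⇒nonNeg {y = y} (inj₂ refl) 0≤y = subst (0# ≤_) (sym (+-identityˡ y)) 0≤y

  nonNeg*nonNeg⇒nonNeg : ∀ {x y} → 0# ≤ x → 0# ≤ y → 0# ≤ x * y
  nonNeg*nonNeg⇒nonNeg (inj₁ 0<x)  (inj₁ 0<y)  = inj₁ (*-pos 0<x 0<y)
  nonNeg*nonNeg⇒nonNeg {y = y} (inj₂ refl) _ = inj₂ (sym (zeroˡ y))
  nonNeg*nonNeg⇒nonNeg {x = x} (inj₁ _) (inj₂ refl) = inj₂ (sym (zeroʳ x))

  nonNeg+nonNeg≡0⇒≡0 : ∀ {x y} → 0# ≤ x → 0# ≤ y → x + y ≡ 0# → x ≡ 0#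
  nonNeg+nonNeg≡0⇒≡0 (inj₁ 0<x)  0≤y x+y≡0 = ⊥-elim (pos⇒≢0 (pos+nonNeg⇒pos 0<x 0≤y) x+y≡0)
  nonNeg+nonNeg≡0⇒≡0 (inj₂ 0≡x) _   _     = sym 0≡x

  0<1 : 0# < 1#
  0<1 with <.compare 0# 1#
  ... | tri< 0<1 _ _ = 0<1
  ... | tri≈ _ 0≡1 _ = ⊥-elim (0≢1 0≡1)
  ... | tri> _ _ 1<0 = ⊥-elim (<.asym 1<0 (subst (0# <_) -1*-1≡1 (*-pos 0<-1 0<-1)))
    where
    0<-1 : 0# < - 1#
    0<-1 = x<0⇒0<-x 1<0
    -1*-1≡1 : - 1# * - 1# ≡ 1#
    -1*-1≡1 = solve 0 (:- 1ₚ :* :- 1ₚ := 1ₚ) refl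

  0<2 : 0# < 2#
  0<2 = pos+nonNeg⇒pos 0<1 (inj₁ 0<1)

  x*y≡0⇒x≡0 : ∀ {x y} → y ≢ 0# → x * y ≡ 0# → x ≡ 0#
  x*y≡0⇒x≡0 {x} {y} y≢0 xy≡0 = begin
    x              ≡⟨ *-identityʳ x ⟨
    x * 1#         ≡⟨ cong (x *_) yy⁻¹≡1 ⟨
    x * (y * y⁻¹)  ≡⟨ *-assoc x y y⁻¹ ⟨
    x * y * y⁻¹    ≡⟨ cong (_* y⁻¹) xy≡0 ⟩
    0# * y⁻¹       ≡⟨ zeroˡ y⁻¹ ⟩
    0#             ∎
    where
    y⁻¹ : Carrier
    y⁻¹ = proj₁ (inverse y y≢0)
    yy⁻¹≡1 : y * y⁻¹ ≡ 1#
    yy⁻¹≡1 = proj₂ (inverse y y≢0)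

  x*y≡1⇒0<y : ∀ {x y} → 0# < x → x * y ≡ 1# → 0# < y
  x*y≡1⇒0<y {x} {y} 0<x xy≡1 with <.compare y 0#
  ... | tri< y<0 _ _ = ⊥-elim (<.asym 0<1 (<-byGap (+-identityˡ (- 1#)) 0<-1))
    where
    0<-1 : 0# < - 1#
    0<-1 = subst (0# <_) (trans (sym (-‿distribʳ-* x y)) (cong -_ xy≡1)) (*-pos 0<x (x<0⇒0<-x y<0))
  ... | tri≈ _ y≡0 _ = ⊥-elim (0≢1 (begin
    0#      ≡⟨ zeroʳ x ⟨
    x * 0#  ≡⟨ cong (x *_) y≡0 ⟨
    x * y   ≡⟨ xy≡1 ⟩
    1#      ∎))
  ... | tri> _ _ 0<y = 0<y

  ½ : Carrier
  ½ = proj₁ (inverse 2# (pos⇒≢0 0<2))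

  2*½≡1 : 2# * ½ ≡ 1#
  2*½≡1 = proj₂ (inverse 2# (pos⇒≢0 0<2))

  0<½ : 0# < ½
  0<½ = x*y≡1⇒0<y 0<2 2*½≡1

  ½*x<x : ∀ {x} → 0# < x → ½ * x < x
  ½*x<x {x} 0<x = <-byGap gap (*-pos 0<½ 0<x)
    where
    gap : x - (½ * x) ≡ ½ * x
    gap = begin
      x - (½ * x)               ≡⟨ cong (_- (½ * x)) (*-identityˡ x) ⟨
      (1# * x) - (½ * x)        ≡⟨ cong (λ c → (c * x) - (½ * x)) 2*½≡1 ⟨
      (2# * ½ * x) - (½ * x)    ≡⟨ solve 2 (λ h x → ((1ₚ :+ 1ₚ) :* h :* x) :- (h :* x) := h :* x) refl ½ x ⟩
      ½ * x                     ∎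

  ½^ : ℕ → Carrier
  ½^ ℕ.zero  = 1#
  ½^ (suc n) = ½ * ½^ n

  0<½^ : ∀ n → 0# < ½^ n
  0<½^ ℕ.zero  = 0<1
  0<½^ (suc n) = *-pos 0<½ (0<½^ n)

  ½^-anti-< : ∀ {m n} → m ℕ.< n → ½^ n < ½^ m
  ½^-anti-< {m} {suc n} (ℕ.s≤s m≤n) with ℕ.m≤n⇒m<n∨m≡n m≤n
  ... | inj₁ m<n  = <.trans (½*x<x (0<½^ n)) (½^-anti-< m<n)
  ... | inj₂ refl = ½*x<x (0<½^ n)

  ½^≤1 : ∀ n → ½^ n ≤ 1#
  ½^≤1 ℕ.zero  = inj₂ refl
  ½^≤1 (suc n) = inj₁ (½^-anti-< {n = suc n} (ℕ.s≤s ℕ.z≤n))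

  ½^-injective : ∀ {m n} → ½^ m ≡ ½^ n → m ≡ n
  ½^-injective {m} {n} ½^m≡½^n with ℕ.<-cmp m n
  ... | tri< m<n _ _ = ⊥-elim (<-irrefl (subst (½^ n <_) ½^m≡½^n (½^-anti-< m<n)))
  ... | tri≈ _ m≡n _ = m≡n
  ... | tri> _ _ n<m = ⊥-elim (<-irrefl (subst (_< ½^ n) ½^m≡½^n (½^-anti-< n<m)))

  commonLowerBound : ∀ {x y} → 0# < x → 0# < y → Σ Carrier λ z → 0# < z × z ≤ x × z ≤ y
  commonLowerBound {x} {y} 0<x 0<y with <.compare x y
  ... | tri< x<y _ _ = x , 0<x , inj₂ refl , inj₁ x<y
  ... | tri≈ _ x≡y _ = x , 0<x , inj₂ refl , inj₂ x≡y
  ... | tri> _ _ y<x = y , 0<y , inj₁ y<x , inj₂ refl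

  nonNeg-combination : ∀ {l m n a b c} → 0# ≤ l → 0# ≤ m → 0# ≤ n →
                       0# ≤ a → 0# ≤ b → 0# ≤ c → 0# ≤ l * a + m * b + n * c
  nonNeg-combination 0≤l 0≤m 0≤n 0≤a 0≤b 0≤c = nonNeg+nonNeg⇒nonNeg
    (nonNeg+nonNeg⇒nonNeg (nonNeg*nonNeg⇒nonNeg 0≤l 0≤a) (nonNeg*nonNeg⇒nonNeg 0≤m 0≤b))
    (nonNeg*nonNeg⇒nonNeg 0≤n 0≤c)

  convex-≤ : ∀ {l m n a b c k} → 0# ≤ l → 0# ≤ m → 0# ≤ n → l + m + n ≡ 1# →
             a ≤ k → b ≤ k → c ≤ k → l * a + m * b + n * c ≤ k
  convex-≤ {l} {m} {n} {a} {b} {c} {k} 0≤l 0≤m 0≤n l+m+n≡1 a≤k b≤k c≤k = ≤-byGap gap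
    (nonNeg-combination 0≤l 0≤m 0≤n (x≤y⇒0≤y-x a≤k) (x≤y⇒0≤y-x b≤k) (x≤y⇒0≤y-x c≤k))
    where
    gap : k - (l * a + m * b + n * c) ≡ l * (k - a) + m * (k - b) + n * (k - c)
    gap = begin
      k - (l * a + m * b + n * c)                ≡⟨ cong (_- (l * a + m * b + n * c)) (*-identityˡ k) ⟨
      (1# * k) - (l * a + m * b + n * c)         ≡⟨ cong (λ s → (s * k) - (l * a + m * b + n * c)) l+m+n≡1 ⟨
      ((l + m + n) * k) - (l * a + m * b + n * c)
        ≡⟨ solve 7 (λ l m n a b c k → ((l :+ m :+ n) :* k) :- (l :* a :+ m :* b :+ n :* c)
                                   := l :* (k :- a) :+ m :* (k :- b) :+ n :* (k :- c)) refl l m n a b c k ⟩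
      l * (k - a) + m * (k - b) + n * (k - c)    ∎

  1≤2 : 1# ≤ 2#
  1≤2 = ≤-byGap (solve 0 ((1ₚ :+ 1ₚ) :- 1ₚ := 1ₚ) refl) (inj₁ 0<1)

  sq-diff≤sq : ∀ {a b c} → 0# ≤ a → a ≤ c → 0# ≤ b → b ≤ c → (b - a) * (b - a) ≤ c * c
  sq-diff≤sq {a} {b} {c} 0≤a a≤c 0≤b b≤c = ≤-byGap gap (nonNeg*nonNeg⇒nonNeg
    (nonNeg+nonNeg⇒nonNeg (x≤y⇒0≤y-x b≤c) 0≤a) (nonNeg+nonNeg⇒nonNeg (x≤y⇒0≤y-x a≤c) 0≤b))
    where
    gap : (c * c) - ((b - a) * (b - a)) ≡ ((c - b) + a) * ((c - a) + b)
    gap = solve 3 (λ a b c → (c :* c) :- ((b :- a) :* (b :- a)) := ((c :- b) :+ a) :* ((c :- a) :+ b)) refl a b c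

  InSquare : Point → Set
  InSquare (x , y) = (0# ≤ x × x ≤ 2#) × (0# ≤ y × y ≤ 2#)

  inSquare⇒dist²<9 : ∀ {p q} → InSquare p → InSquare q → dist² p q < 3# * 3#
  inSquare⇒dist²<9 {x₁ , y₁} {x₂ , y₂} ((0≤x₁ , x₁≤2) , 0≤y₁ , y₁≤2) ((0≤x₂ , x₂≤2) , 0≤y₂ , y₂≤2) =
    <-byGap (gap ((x₂ - x₁) * (x₂ - x₁)) ((y₂ - y₁) * (y₂ - y₁))) (pos+nonNeg⇒pos 0<1 (nonNeg+nonNeg⇒nonNeg
      (x≤y⇒0≤y-x (sq-diff≤sq 0≤x₁ x₁≤2 0≤x₂ x₂≤2)) (x≤y⇒0≤y-x (sq-diff≤sq 0≤y₁ y₁≤2 0≤y₂ y₂≤2))))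
    where
    gap : ∀ u v → (3# * 3#) - (u + v) ≡ 1# + (((2# * 2#) - u) + ((2# * 2#) - v))
    gap = solve 2 (λ u v → (((1ₚ :+ 1ₚ) :+ 1ₚ) :* ((1ₚ :+ 1ₚ) :+ 1ₚ)) :- (u :+ v)
                        := 1ₚ :+ ((((1ₚ :+ 1ₚ) :* (1ₚ :+ 1ₚ)) :- u) :+ (((1ₚ :+ 1ₚ) :* (1ₚ :+ 1ₚ)) :- v))) refl

  triangle : Carrier → Triangle
  triangle t = tri (t + 1# , t) (t - (t * t) , t) (t , 0#)

  triangle-rightAngled : ∀ t → RightAngled (triangle t)
  triangle-rightAngled t = inj₂ (inj₂ (solve 1 (λ t →
    ((t :+ 1ₚ) :- t) :* ((t :- (t :* t)) :- t) :+ (t :- 0ₚ) :* (t :- 0ₚ) := 0ₚ) refl t))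

  -- `_-_` has no fixity declaration, so in `area2` it binds tighter than `_*_`.
  area2-triangle : ∀ t → area2 (triangle t) ≡ - (t + t * (t * t))
  area2-triangle = solve 1 (λ t →
    ((t :- (t :* t)) :- (t :+ 1ₚ)) :* ((0ₚ :- t) :- (t :- t)) :* (t :- (t :+ 1ₚ))
      := :- (t :+ t :* (t :* t))) refl

  triangle-nonZeroArea : ∀ {t} → 0# < t → NonZeroArea (triangle t)
  triangle-nonZeroArea {t} 0<t area≡0 = pos⇒≢0 0<t+t³ (-‿injective (begin
    - (t + t * (t * t))  ≡⟨ area2-triangle t ⟨
    area2 (triangle t)   ≡⟨ area≡0 ⟩
    0#                   ≡⟨ -0#≈0# ⟨
    - 0#                 ∎))
    where
    0≤t : 0# ≤ t
    0≤t = inj₁ 0<t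
    0<t+t³ : 0# < t + t * (t * t)
    0<t+t³ = pos+nonNeg⇒pos 0<t (nonNeg*nonNeg⇒nonNeg 0≤t (nonNeg*nonNeg⇒nonNeg 0≤t 0≤t))

  foot∈triangle : ∀ t → (t , 0#) ∈T triangle t
  foot∈triangle t = 0# , 0# , 1# , inj₂ refl , inj₂ refl , inj₁ 0<1 , weights , x≡ t , y≡ t
    where
    weights : 0# + 0# + 1# ≡ 1#
    weights = solve 0 (0ₚ :+ 0ₚ :+ 1ₚ := 1ₚ) refl
    x≡ : ∀ t → t ≡ 0# * (t + 1#) + 0# * (t - (t * t)) + 1# * t
    x≡ = solve 1 (λ t → t := 0ₚ :* (t :+ 1ₚ) :+ 0ₚ :* (t :- (t :* t)) :+ 1ₚ :* t) refl
    y≡ : ∀ t → 0# ≡ 0# * t + 0# * t + 1# * 0#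
    y≡ = solve 1 (λ t → 0ₚ := 0ₚ :* t :+ 0ₚ :* t :+ 1ₚ :* 0ₚ) refl

  meet∈triangle : ∀ {s} t → 0# ≤ s → s ≤ 1# → (t + s , t * s) ∈T triangle t
  meet∈triangle {s} t 0≤s s≤1 =
    s , 0# , 1# - s , 0≤s , inj₂ refl , x≤y⇒0≤y-x s≤1 , weights s , x≡ t s , y≡ t s
    where
    weights : ∀ s → s + 0# + (1# - s) ≡ 1#
    weights = solve 1 (λ s → s :+ 0ₚ :+ (1ₚ :- s) := 1ₚ) refl
    x≡ : ∀ t s → t + s ≡ s * (t + 1#) + 0# * (t - (t * t)) + (1# - s) * t
    x≡ = solve 2 (λ t s → t :+ s := s :* (t :+ 1ₚ) :+ 0ₚ :* (t :- (t :* t)) :+ (1ₚ :- s) :* t) refl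
    y≡ : ∀ t s → t * s ≡ s * t + 0# * t + (1# - s) * 0#
    y≡ = solve 2 (λ t s → t :* s := s :* t :+ 0ₚ :* t :+ (1ₚ :- s) :* 0ₚ) refl

  ∈triangle⇒x-bounds : ∀ {t x y} → 0# ≤ t → t ≤ 1# → (x , y) ∈T triangle t → 0# ≤ x × x ≤ 2#
  ∈triangle⇒x-bounds {t} 0≤t t≤1 (l , m , n , 0≤l , 0≤m , 0≤n , Σ≡1 , refl , _) =
    nonNeg-combination 0≤l 0≤m 0≤n 0≤t+1 0≤t-t² 0≤t ,
    convex-≤ 0≤l 0≤m 0≤n Σ≡1 t+1≤2 (≤-trans t-t²≤t t≤2) t≤2
    where
    t≤2 : t ≤ 2#
    t≤2 = ≤-trans t≤1 1≤2
    0≤t+1 : 0# ≤ t + 1#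
    0≤t+1 = nonNeg+nonNeg⇒nonNeg 0≤t (inj₁ 0<1)
    0≤t-t² : 0# ≤ t - (t * t)
    0≤t-t² = subst (0# ≤_) (solve 1 (λ t → t :* (1ₚ :- t) := t :- (t :* t)) refl t)
                           (nonNeg*nonNeg⇒nonNeg 0≤t (x≤y⇒0≤y-x t≤1))
    t+1≤2 : t + 1# ≤ 2#
    t+1≤2 = ≤-byGap (solve 1 (λ t → (1ₚ :+ 1ₚ) :- (t :+ 1ₚ) := 1ₚ :- t) refl t) (x≤y⇒0≤y-x t≤1)
    t-t²≤t : t - (t * t) ≤ t
    t-t²≤t = ≤-byGap (solve 1 (λ t → t :- (t :- (t :* t)) := t :* t) refl t) (nonNeg*nonNeg⇒nonNeg 0≤t 0≤t)

  ∈triangle⇒y-bounds : ∀ {t x y} → 0# ≤ t → (x , y) ∈T triangle t → 0# ≤ y × y ≤ t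
  ∈triangle⇒y-bounds 0≤t (l , m , n , 0≤l , 0≤m , 0≤n , Σ≡1 , _ , refl) =
    nonNeg-combination 0≤l 0≤m 0≤n 0≤t 0≤t (inj₂ refl) ,
    convex-≤ 0≤l 0≤m 0≤n Σ≡1 (inj₂ refl) (inj₂ refl) 0≤t

  ∈triangle-onAxis : ∀ {t x} → 0# < t → (x , 0#) ∈T triangle t → x ≡ t
  ∈triangle-onAxis {t} 0<t (l , m , n , 0≤l , 0≤m , 0≤n , Σ≡1 , refl , 0≡y) = begin
    l * (t + 1#) + m * (t - (t * t)) + n * t  ≡⟨ cong₂ (λ l m → l * (t + 1#) + m * (t - (t * t)) + n * t) l≡0 m≡0 ⟩
    0# * (t + 1#) + 0# * (t - (t * t)) + n * t ≡⟨ solve 2 (λ t n → 0ₚ :* (t :+ 1ₚ) :+ 0ₚ :* (t :- (t :* t)) :+ n :* t := n :* t) refl t n ⟩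
    n * t                                      ≡⟨ cong (_* t) n≡1 ⟩
    1# * t                                     ≡⟨ *-identityˡ t ⟩
    t                                          ∎
    where
    l+m≡0 : l + m ≡ 0#
    l+m≡0 = x*y≡0⇒x≡0 (pos⇒≢0 0<t) (trans [l+m]t≡y (sym 0≡y))
      where
      [l+m]t≡y : (l + m) * t ≡ l * t + m * t + n * 0#
      [l+m]t≡y = solve 4 (λ l m n t → (l :+ m) :* t := l :* t :+ m :* t :+ n :* 0ₚ) refl l m n t
    l≡0 : l ≡ 0#
    l≡0 = nonNeg+nonNeg≡0⇒≡0 0≤l 0≤m l+m≡0
    m≡0 : m ≡ 0#
    m≡0 = nonNeg+nonNeg≡0⇒≡0 0≤m 0≤l (trans (+-comm m l) l+m≡0)
    n≡1 : n ≡ 1#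
    n≡1 = begin
      n            ≡⟨ +-identityˡ n ⟨
      0# + n       ≡⟨ cong (_+ n) l+m≡0 ⟨
      l + m + n    ≡⟨ Σ≡1 ⟩
      1#           ∎

  triangle-injective : ∀ {s t} → 0# < t → SameSet (triangle s) (triangle t) → s ≡ t
  triangle-injective {s} 0<t same = ∈triangle-onAxis 0<t (proj₁ (same (s , 0#)) (foot∈triangle s))

  ∈triangle⇒inSquare : ∀ {t p} → 0# ≤ t → t ≤ 1# → p ∈T triangle t → InSquare p
  ∈triangle⇒inSquare 0≤t t≤1 p∈ with ∈triangle⇒y-bounds 0≤t p∈
  ... | 0≤y , y≤t = ∈triangle⇒x-bounds 0≤t t≤1 p∈ , 0≤y , ≤-trans y≤t (≤-trans t≤1 1≤2)

  AvoidsBelow : Point → Carrier → Set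
  AvoidsBelow p s = ∀ {t} → 0# < t → t ≤ s → ¬ p ∈T triangle t

  avoidsBelow-≤ : ∀ {p r s} → r ≤ s → AvoidsBelow p s → AvoidsBelow p r
  avoidsBelow-≤ r≤s avoids 0<t t≤r = avoids 0<t (≤-trans t≤r r≤s)

  avoidsBelow-exists : ∀ p → Σ Carrier λ s → 0# < s × AvoidsBelow p s
  avoidsBelow-exists (x , y) with <.compare y 0#
  ... | tri< y<0 _ _ = 1# , 0<1 , λ 0<t _ p∈ →
    <-irrefl (≤-<-trans (proj₁ (∈triangle⇒y-bounds (inj₁ 0<t) p∈)) y<0)
  ... | tri> _ _ 0<y = ½ * y , *-pos 0<½ 0<y , λ 0<t t≤½y p∈ →
    <-irrefl (≤-<-trans (proj₂ (∈triangle⇒y-bounds (inj₁ 0<t) p∈)) (≤-<-trans t≤½y (½*x<x 0<y)))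
  ... | tri≈ _ refl _ with <.compare 0# x
  ...   | tri< 0<x _ _ = ½ * x , *-pos 0<½ 0<x , λ 0<t t≤½x p∈ →
    <-irrefl (subst (_< x) (sym (∈triangle-onAxis 0<t p∈)) (≤-<-trans t≤½x (½*x<x 0<x)))
  ...   | tri≈ _ 0≡x _ = 1# , 0<1 , λ 0<t _ p∈ →
    pos⇒≢0 0<t (trans (sym (∈triangle-onAxis 0<t p∈)) (sym 0≡x))
  ...   | tri> _ _ x<0 = 1# , 0<1 , λ 0<t _ p∈ →
    <.asym 0<t (subst (_< 0#) (∈triangle-onAxis 0<t p∈) x<0)

  avoidsBelow-all : (ps : List Point) → Σ Carrier λ s → 0# < s × All (λ p → AvoidsBelow p s) ps
  avoidsBelow-all []       = 1# , 0<1 , []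
  avoidsBelow-all (p ∷ ps) with avoidsBelow-exists p | avoidsBelow-all ps
  ... | r , 0<r , avoids | s , 0<s , allAvoid with commonLowerBound 0<r 0<s
  ...   | u , 0<u , u≤r , u≤s =
    u , 0<u , avoidsBelow-≤ u≤r avoids ∷ All.map (avoidsBelow-≤ u≤s) allAvoid

  Parameter : Set
  Parameter = Σ Carrier λ t → 0# < t × t ≤ 1#

  family : Parameter → Triangle
  family (t , _) = triangle t

  family-infinite : InfiniteFamily family
  family-infinite = (λ n → ½^ n , 0<½^ n , ½^≤1 n) ,
    λ m n m≢n same → m≢n (½^-injective (triangle-injective (0<½^ n) same))

  family-intersecting : ∀ i j → Intersect (family i) (family j)
  family-intersecting (s , 0<s , s≤1) (t , 0<t , t≤1) =
    (s + t , s * t) , meet∈triangle s (inj₁ 0<t) t≤1 ,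
    subst (_∈T triangle t) (cong₂ _,_ (+-comm t s) (*-comm t s)) (meet∈triangle t (inj₁ 0<s) s≤1)

  family-boundedDiameters : BoundedDiameters family
  family-boundedDiameters = 3# , pos+nonNeg⇒pos 0<2 (inj₁ 0<1) ,
    λ (t , 0<t , t≤1) _ _ p∈ q∈ →
      inSquare⇒dist²<9 (∈triangle⇒inSquare (inj₁ 0<t) t≤1 p∈) (∈triangle⇒inSquare (inj₁ 0<t) t≤1 q∈)

  family-notPierced : ∀ ps → ¬ Pierces ps family
  family-notPierced ps pierces with avoidsBelow-all ps
  ... | s , 0<s , allAvoid with commonLowerBound 0<s 0<1
  ...   | t , 0<t , t≤s , t≤1 =
    All.lookupWith (λ avoids p∈ → avoids 0<t t≤s p∈) allAvoid (pierces (t , 0<t , t≤1))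

theorem18 : (ℝ : RealField) → let open Geometry ℝ in
    Σ Set λ I → Σ (I → Triangle) λ F →
      InfiniteFamily F ×
      (∀ i → RightAngled (F i)) ×
      (∀ i → NonZeroArea (F i)) ×
      (∀ i j → Intersect (F i) (F j)) ×
      BoundedDiameters F ×
      (∀ (ps : List Point) → ¬ Pierces ps F)
theorem18 ℝ = Parameter , family , family-infinite ,
  (λ (t , _) → triangle-rightAngled t) , (λ (_ , 0<t , _) → triangle-nonZeroArea 0<t) ,
  family-intersecting , family-boundedDiameters , family-notPierced
  where open Construction ℝ
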